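{- Let $d\ge 1$ and let $x_1,\dots,x_d,y_1,\dots,y_{d-1}$ be pairwise distinct integers. Then, as rational functions in $q$, \[ \sum_{k=1}^d\frac{\displaystyle \prod_{i=1,i\ne k}^dw(x_k-x_i)}{\displaystyle \prod_{i=1}^{d-1}w(x_k-y_i)}+\sum_{k=1}^{d-1}\frac{\displaystyle \prod_{i=1,i\ne k}^{d-1}w(y_k-y_i)}{\displaystyle \prod_{i=1}^dw(y_k-x_i)}=1, \] where $w(h)=\dfrac{1+q^h}{1-q^h}$ for a nonzero integer $h$.
   Context: $q$ is an indeterminate; all expressions are regarded in the field $\mathbf{Q}(q)$ (negative powers of $q$ allowed). -}

module Defs where

-- The field Q(q) is built here as the fraction field of the polynomial ring Q[q]:
--   * Poly  : polynomials over ℚ as coefficient lists (constant term first),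
--             compared extensionally coefficient-wise (_≈ₚ_), so trailing zeros
--             do not matter;
--   * Frac  : pairs num/den of polynomials, with the usual fraction equality
--             a/b ≈ c/d  iff  a*d ≈ c*b;
--   * invF  : total inverse (inverse of 0 is defined as 0, as in Lean/Mathlib);
--             it is only ever applied to nonzero elements in the statement,
--             and it never produces a zero denominator.

open import Data.Nat using (ℕ; zero; suc)
open import Data.Integer using (ℤ; +_; -[1+_])
open import Data.Rational as Q using (ℚ; 0ℚ; 1ℚ)
open import Data.List using (List; []; _∷_; map)
open import Data.Bool using (Bool; true; false; _∧_; if_then_else_)
open import Data.Fin using (Fin; zero; suc)
open import Relation.Nullary using (does)
open import Relation.Binary.PropositionalEquality using (_≡_)

Poly : Set
Poly = List ℚ

coeff : Poly → ℕ → ℚ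
coeff []       _       = 0ℚ
coeff (a ∷ p)  zero    = a
coeff (a ∷ p)  (suc n) = coeff p n

infix 4 _≈ₚ_
_≈ₚ_ : Poly → Poly → Set
p ≈ₚ r = ∀ n → coeff p n ≡ coeff r n

infixl 6 _+ₚ_
_+ₚ_ : Poly → Poly → Poly
[]      +ₚ r       = r
(a ∷ p) +ₚ []      = a ∷ p
(a ∷ p) +ₚ (b ∷ r) = (a Q.+ b) ∷ (p +ₚ r)

-ₚ_ : Poly → Poly
-ₚ p = map Q.-_ p

infixl 7 _*ₚ_
_*ₚ_ : Poly → Poly → Poly
[]      *ₚ r = []
(a ∷ p) *ₚ r = map (a Q.*_) r +ₚ (0ℚ ∷ (p *ₚ r))

isZeroₚ : Poly → Bool
isZeroₚ []      = true
isZeroₚ (a ∷ p) = does (a Q.≟ 0ℚ) ∧ isZeroₚ p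

record Frac : Set where
  constructor _/ₚ_
  field
    num : Poly
    den : Poly
open Frac public

infix 4 _≈F_
_≈F_ : Frac → Frac → Set
a ≈F b = num a *ₚ den b ≈ₚ num b *ₚ den a

0F 1F qF : Frac
0F = [] /ₚ (1ℚ ∷ [])
1F = (1ℚ ∷ []) /ₚ (1ℚ ∷ [])
qF = (0ℚ ∷ 1ℚ ∷ []) /ₚ (1ℚ ∷ [])

infixl 6 _+F_ _-F_
infixl 7 _*F_
_+F_ : Frac → Frac → Frac
a +F b = (num a *ₚ den b +ₚ num b *ₚ den a) /ₚ (den a *ₚ den b)

-F_ : Frac → Frac
-F a = (-ₚ num a) /ₚ den a

_-F_ : Frac → Frac → Frac
a -F b = a +F (-F b)

_*F_ : Frac → Frac → Frac
a *F b = (num a *ₚ num b) /ₚ (den a *ₚ den b)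

invF : Frac → Frac
invF a = if isZeroₚ (num a) then 0F else (den a /ₚ num a)

powℕ : Frac → ℕ → Frac
powℕ a zero    = 1F
powℕ a (suc n) = a *F powℕ a n

powℤ : Frac → ℤ → Frac
powℤ a (+ n)      = powℕ a n
powℤ a -[1+ n ]   = invF (powℕ a (suc n))

w : ℤ → Frac
w h = (1F +F powℤ qF h) *F invF (1F -F powℤ qF h)

sumF : ∀ {n} → (Fin n → Frac) → Frac
sumF {zero}  f = 0F
sumF {suc n} f = f zero +F sumF (λ i → f (suc i))

prodF : ∀ {n} → (Fin n → Frac) → Frac
prodF {zero}  f = 1F
prodF {suc n} f = f zero *F prodF (λ i → f (suc i))

prodExcept : ∀ {n} → Fin n → (Fin n → Frac) → Frac
prodExcept k f = prodF (λ i → if does (i Data.Fin.≟ k) then 1F else f i)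

-- Both sides are compared at the infinitely many points q = a with a = 2, 3, 4, …:
-- a polynomial with infinitely many roots is zero, so these values determine an
-- element of Q(q).  At q = a > 1, w (c − b) takes the value ω (a^b) (a^c), where
-- ω s t = (s + t)/(s − t).  For the 2d − 1 distinct nonzero points
--   z = (a^x₁, …, a^x_d, −a^y₁, …, −a^y_{d−1})
-- the two sums together become Σ_k c_k with c_k = Π_{r≠k} ω (z_r) (z_k).  These c_k
-- are the coefficients of the partial-fraction expansion
--   Π_r (z_r + t)/(z_r − t) = (−1)ⁿ + Σ_k c_k · 2z_k/(z_k − t),
-- proved by induction on n; at t = 0 it reads 1 = (−1)ⁿ + 2 Σ_k c_k, so Σ_k c_k = 1
-- because n = 2d − 1 is odd.

module Submission where

open import Algebra.Bundles using (Monoid; Semiring; CommutativeRing)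
open import Data.Bool using (true; false; if_then_else_)
open import Data.Empty using (⊥-elim)
open import Data.Fin using (Fin; zero; suc; _↑ˡ_; _↑ʳ_; _≟_; splitAt)
import Data.Fin.Properties as Fin
open import Data.Integer as ℤ using (ℤ; -[1+_]; _⊖_)
import Data.Integer.Properties as ℤ
open import Algebra.Properties.AbelianGroup ℤ.+-0-abelianGroup using (xyx⁻¹≈y)
open import Data.List using ([]; _∷_; map; length)
open import Data.Nat as ℕ using (ℕ; zero; suc)
import Data.Nat.Properties as ℕ
open import Data.Rational as ℚ using (ℚ; 0ℚ; 1ℚ; _+_; _*_; -_; _-_; _<_)
import Data.Rational.Properties as ℚ
open import Data.Rational.Solver using (module +-*-Solver)
open +-*-Solver
open import Data.Sum using (_⊎_; inj₁; inj₂; [_,_]; [_,_]′)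
open import Data.Vec.Functional using (Vector; _++_)
open import Data.Vec.Functional.Properties using (lookup-++ˡ; lookup-++ʳ)
open import Function using (_∘_; id)
open import Function.Definitions using (Injective)
open import Relation.Binary.Definitions using (tri<; tri≈; tri>)
open import Relation.Binary.PropositionalEquality
  using (_≡_; _≢_; _≗_; refl; sym; trans; cong; cong₂; subst; module ≡-Reasoning)
open import Relation.Nullary using (does; yes; no)

open import Defs

++-injective : ∀ {a} {A : Set a} {m n} {U : Vector A m} {W : Vector A n} →
               Injective _≡_ _≡_ U → Injective _≡_ _≡_ W → (∀ i j → U i ≢ W j) → Injective _≡_ _≡_ (U ++ W)
++-injective {m = m} {n} {U = U} {W} U-inj W-inj U≢W {r} {s} e
  with splitAt m r in r≡ | splitAt m s in s≡
... | inj₁ i | inj₁ j = trans (sym (Fin.splitAt⁻¹-↑ˡ r≡)) (trans (cong (_↑ˡ n) (U-inj e)) (Fin.splitAt⁻¹-↑ˡ s≡))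
... | inj₁ i | inj₂ j = ⊥-elim (U≢W i j e)
... | inj₂ i | inj₁ j = ⊥-elim (U≢W j i (sym e))
... | inj₂ i | inj₂ j = trans (sym (Fin.splitAt⁻¹-↑ʳ r≡)) (trans (cong (m ↑ʳ_) (W-inj e)) (Fin.splitAt⁻¹-↑ʳ s≡))

++-all : ∀ {a p} {A : Set a} {P : A → Set p} {m n} {U : Vector A m} {W : Vector A n} →
         (∀ i → P (U i)) → (∀ j → P (W j)) → ∀ r → P ((U ++ W) r)
++-all {m = m} PU PW r with splitAt m r
... | inj₁ i = PU i
... | inj₂ j = PW j

module MonoidSum {a ℓ} (M : Monoid a ℓ) where

  open Monoid M using (Carrier; _≈_; _∙_; ε; setoid; ∙-congˡ; identityˡ; assoc)
    renaming (sym to ≈-sym; trans to ≈-trans)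
  open import Algebra.Properties.Monoid.Sum M public using (sum; sum-cong-≗; sum-replicate-zero)
  open import Relation.Binary.Reasoning.Setoid setoid

  -- As in prodExcept, the k-th term is replaced by ε rather than removed, so that
  -- sumExcept (suc k) f unfolds to f zero ∙ sumExcept k (f ∘ suc).
  sumExcept : ∀ {n} → Fin n → Vector Carrier n → Carrier
  sumExcept k f = sum (λ i → if does (i ≟ k) then ε else f i)

  sumExcept-cong-≗ : ∀ {n} k {f g : Vector Carrier n} → f ≗ g → sumExcept k f ≡ sumExcept k g
  sumExcept-cong-≗ k f≗g = sum-cong-≗ (λ i → cong (if does (i ≟ k) then ε else_) (f≗g i))

  sum-++ : ∀ m {n} (f : Vector Carrier (m ℕ.+ n)) → sum f ≈ sum (f ∘ (_↑ˡ n)) ∙ sum (f ∘ (m ↑ʳ_))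
  sum-++ zero    f = ≈-sym (identityˡ (sum f))
  sum-++ (suc m) {n} f = begin
    f zero ∙ sum (f ∘ suc)                                         ≈⟨ ∙-congˡ (sum-++ m (f ∘ suc)) ⟩
    f zero ∙ (sum (f ∘ suc ∘ (_↑ˡ n)) ∙ sum (f ∘ suc ∘ (m ↑ʳ_)))  ≈⟨ assoc _ _ _ ⟨
    f zero ∙ sum (f ∘ suc ∘ (_↑ˡ n)) ∙ sum (f ∘ suc ∘ (m ↑ʳ_))    ∎

  sumExcept-↑ˡ : ∀ {m n} (k : Fin m) (f : Vector Carrier (m ℕ.+ n)) →
                 sumExcept (k ↑ˡ n) f ≈ sumExcept k (f ∘ (_↑ˡ n)) ∙ sum (f ∘ (m ↑ʳ_))
  sumExcept-↑ˡ {suc m} zero    f = ≈-trans (∙-congˡ (sum-++ m (f ∘ suc))) (≈-sym (assoc _ _ _))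
  sumExcept-↑ˡ {suc m} (suc k) f = ≈-trans (∙-congˡ (sumExcept-↑ˡ k (f ∘ suc))) (≈-sym (assoc _ _ _))

  sumExcept-↑ʳ : ∀ m {n} (k : Fin n) (f : Vector Carrier (m ℕ.+ n)) →
                 sumExcept (m ↑ʳ k) f ≈ sum (f ∘ (_↑ˡ n)) ∙ sumExcept k (f ∘ (m ↑ʳ_))
  sumExcept-↑ʳ zero    k f = ≈-sym (identityˡ _)
  sumExcept-↑ʳ (suc m) k f = ≈-trans (∙-congˡ (sumExcept-↑ʳ m k (f ∘ suc))) (≈-sym (assoc _ _ _))

infixl 9 _⁻¹

opaque
  _⁻¹ : ℚ → ℚ
  p ⁻¹ with p ℚ.≟ 0ℚ
  ... | yes _  = 0ℚ
  ... | no p≢0 = ℚ.1/_ p {{ℚ.≢-nonZero p≢0}}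

  ⁻¹-inverseʳ : ∀ {p} → p ≢ 0ℚ → p * p ⁻¹ ≡ 1ℚ
  ⁻¹-inverseʳ {p} p≢0 with p ℚ.≟ 0ℚ
  ... | yes p≡0 = ⊥-elim (p≢0 p≡0)
  ... | no p≢0′ = ℚ.*-inverseʳ p {{ℚ.≢-nonZero p≢0′}}

  0⁻¹≡0 : 0ℚ ⁻¹ ≡ 0ℚ
  0⁻¹≡0 = refl

  pos⇒⁻¹-pos : ∀ {p} → 0ℚ < p → 0ℚ < p ⁻¹
  pos⇒⁻¹-pos {p} 0<p with p ℚ.≟ 0ℚ
  ... | yes p≡0 = ⊥-elim (ℚ.<⇒≢ 0<p (sym p≡0))
  ... | no _    = ℚ.positive⁻¹ _ {{ℚ.1/pos⇒pos p {{ℚ.positive 0<p}}}}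

1≢0 : 1ℚ ≢ 0ℚ
1≢0 ()

p*q≡0⇒p≡0∨q≡0 : ∀ p {q} → p * q ≡ 0ℚ → p ≡ 0ℚ ⊎ q ≡ 0ℚ
p*q≡0⇒p≡0∨q≡0 p {q} pq≡0 with p ℚ.≟ 0ℚ
... | yes p≡0 = inj₁ p≡0
... | no p≢0  = inj₂ (begin
  q               ≡⟨ ℚ.*-identityˡ q ⟨
  1ℚ * q          ≡⟨ cong (_* q) (⁻¹-inverseʳ p≢0) ⟨
  p * p ⁻¹ * q    ≡⟨ solve 3 (λ p i q → p :* i :* q := i :* (p :* q)) refl p (p ⁻¹) q ⟩
  p ⁻¹ * (p * q)  ≡⟨ cong (p ⁻¹ *_) pq≡0 ⟩
  p ⁻¹ * 0ℚ       ≡⟨ ℚ.*-zeroʳ (p ⁻¹) ⟩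
  0ℚ              ∎)
  where open ≡-Reasoning

p*q≢0 : ∀ {p q} → p ≢ 0ℚ → q ≢ 0ℚ → p * q ≢ 0ℚ
p*q≢0 {p} p≢0 q≢0 pq≡0 = [ p≢0 , q≢0 ] (p*q≡0⇒p≡0∨q≡0 p pq≡0)

p≢0⇒p⁻¹≢0 : ∀ {p} → p ≢ 0ℚ → p ⁻¹ ≢ 0ℚ
p≢0⇒p⁻¹≢0 {p} p≢0 p⁻¹≡0 = 1≢0 (begin
  1ℚ         ≡⟨ ⁻¹-inverseʳ p≢0 ⟨
  p * p ⁻¹   ≡⟨ cong (p *_) p⁻¹≡0 ⟩
  p * 0ℚ     ≡⟨ ℚ.*-zeroʳ p ⟩
  0ℚ         ∎)
  where open ≡-Reasoning

⁻¹-unique : ∀ {p q} → p * q ≡ 1ℚ → p ⁻¹ ≡ q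
⁻¹-unique {p} {q} pq≡1 = begin
  p ⁻¹             ≡⟨ ℚ.*-identityʳ (p ⁻¹) ⟨
  p ⁻¹ * 1ℚ        ≡⟨ cong (p ⁻¹ *_) pq≡1 ⟨
  p ⁻¹ * (p * q)   ≡⟨ solve 3 (λ i p q → i :* (p :* q) := (p :* i) :* q) refl (p ⁻¹) p q ⟩
  (p * p ⁻¹) * q   ≡⟨ cong (_* q) (⁻¹-inverseʳ p≢0) ⟩
  1ℚ * q           ≡⟨ ℚ.*-identityˡ q ⟩
  q                ∎
  where
  open ≡-Reasoning
  p≢0 : p ≢ 0ℚ
  p≢0 refl = 1≢0 (trans (sym pq≡1) (ℚ.*-zeroˡ q))

1⁻¹≡1 : 1ℚ ⁻¹ ≡ 1ℚ
1⁻¹≡1 = ⁻¹-unique refl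

⁻¹-involutive : ∀ p → p ⁻¹ ⁻¹ ≡ p
⁻¹-involutive p with p ℚ.≟ 0ℚ
... | yes refl = trans (cong _⁻¹ 0⁻¹≡0) 0⁻¹≡0
... | no p≢0   = ⁻¹-unique (trans (ℚ.*-comm (p ⁻¹) p) (⁻¹-inverseʳ p≢0))

⁻¹-distrib-* : ∀ p q → (p * q) ⁻¹ ≡ p ⁻¹ * q ⁻¹
⁻¹-distrib-* p q with p ℚ.≟ 0ℚ | q ℚ.≟ 0ℚ
... | yes refl | _ = trans (cong _⁻¹ (ℚ.*-zeroˡ q)) (trans 0⁻¹≡0 (sym (trans (cong (_* q ⁻¹) 0⁻¹≡0) (ℚ.*-zeroˡ (q ⁻¹)))))
... | no _ | yes refl = trans (cong _⁻¹ (ℚ.*-zeroʳ p)) (trans 0⁻¹≡0 (sym (trans (cong (p ⁻¹ *_) 0⁻¹≡0) (ℚ.*-zeroʳ (p ⁻¹)))))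
... | no p≢0 | no q≢0 = ⁻¹-unique (begin
  (p * q) * (p ⁻¹ * q ⁻¹)    ≡⟨ solve 4 (λ p q i j → (p :* q) :* (i :* j) := (p :* i) :* (q :* j)) refl p q (p ⁻¹) (q ⁻¹) ⟩
  (p * p ⁻¹) * (q * q ⁻¹)   ≡⟨ cong₂ _*_ (⁻¹-inverseʳ p≢0) (⁻¹-inverseʳ q≢0) ⟩
  1ℚ                        ∎)
  where open ≡-Reasoning

neg-distrib-⁻¹ : ∀ p → (- p) ⁻¹ ≡ - p ⁻¹
neg-distrib-⁻¹ p with p ℚ.≟ 0ℚ
... | yes refl = trans 0⁻¹≡0 (cong -_ (sym 0⁻¹≡0))
... | no p≢0   = ⁻¹-unique (trans (solve 2 (λ p i → (:- p) :* (:- i) := p :* i) refl p (p ⁻¹)) (⁻¹-inverseʳ p≢0))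

p-q≡0⇒p≡q : ∀ {p q} → p - q ≡ 0ℚ → p ≡ q
p-q≡0⇒p≡q {p} {q} p-q≡0 = begin
  p              ≡⟨ solve 2 (λ p q → p := (p :- q) :+ q) refl p q ⟩
  (p - q) + q    ≡⟨ cong (_+ q) p-q≡0 ⟩
  0ℚ + q         ≡⟨ ℚ.+-identityˡ q ⟩
  q              ∎
  where open ≡-Reasoning

p-q≢0 : ∀ {p q} → p ≢ q → p - q ≢ 0ℚ
p-q≢0 p≢q = p≢q ∘ p-q≡0⇒p≡q

pos*pos⇒pos : ∀ {p q} → 0ℚ < p → 0ℚ < q → 0ℚ < p * q
pos*pos⇒pos {p} {q} 0<p 0<q = ℚ.positive⁻¹ (p * q) {{ℚ.pos*pos⇒pos p {{ℚ.positive 0<p}} q {{ℚ.positive 0<q}}}}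

pos+pos≢0 : ∀ {p q} → 0ℚ < p → 0ℚ < q → p + q ≢ 0ℚ
pos+pos≢0 0<p 0<q p+q≡0 = ℚ.<⇒≢ (ℚ.+-mono-< 0<p 0<q) (sym p+q≡0)

1<a⇒0<a : ∀ {a} → 1ℚ < a → 0ℚ < a
1<a⇒0<a = ℚ.<-trans (ℚ.positive⁻¹ 1ℚ)

0<a⇒a≢0 : ∀ {a} → 0ℚ < a → a ≢ 0ℚ
0<a⇒a≢0 0<a a≡0 = ℚ.<⇒≢ 0<a (sym a≡0)

1<a⇒a≢0 : ∀ {a} → 1ℚ < a → a ≢ 0ℚ
1<a⇒a≢0 = 0<a⇒a≢0 ∘ 1<a⇒0<a

p<p+1 : ∀ p → p < p + 1ℚ
p<p+1 p = subst (_< p + 1ℚ) (ℚ.+-identityʳ p) (ℚ.+-monoʳ-< p (ℚ.positive⁻¹ 1ℚ))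

-- ω (a ^ℤ b) (a ^ℤ c) is the value of w (c − b) at q = a (HasValue-w-sub).
ω : ℚ → ℚ → ℚ
ω s t = (s + t) * (s - t) ⁻¹

ω-scale : ∀ {c} s t → c ≢ 0ℚ → ω (c * s) (c * t) ≡ ω s t
ω-scale {c} s t c≢0 = begin
  (c * s + c * t) * (c * s - c * t) ⁻¹      ≡⟨ cong₂ (λ x y → x * y ⁻¹) (sym (ℚ.*-distribˡ-+ c s t)) (solve 3 (λ c s t → c :* s :- c :* t := c :* (s :- t)) refl c s t) ⟩
  (c * (s + t)) * (c * (s - t)) ⁻¹          ≡⟨ cong ((c * (s + t)) *_) (⁻¹-distrib-* c (s - t)) ⟩
  (c * (s + t)) * (c ⁻¹ * (s - t) ⁻¹)       ≡⟨ solve 4 (λ c i x y → (c :* x) :* (i :* y) := (c :* i) :* (x :* y)) refl c (c ⁻¹) (s + t) ((s - t) ⁻¹) ⟩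
  (c * c ⁻¹) * ((s + t) * (s - t) ⁻¹)       ≡⟨ cong (_* ω s t) (⁻¹-inverseʳ c≢0) ⟩
  1ℚ * ω s t                                ≡⟨ ℚ.*-identityˡ (ω s t) ⟩
  ω s t                                     ∎
  where open ≡-Reasoning

ω-negʳ : ∀ s t → ω s (- t) ≡ (ω s t) ⁻¹
ω-negʳ s t = begin
  (s - t) * (s - - t) ⁻¹          ≡⟨ cong (λ x → (s - t) * x ⁻¹) (solve 2 (λ s t → s :- (:- t) := s :+ t) refl s t) ⟩
  (s - t) * (s + t) ⁻¹            ≡⟨ cong (_* (s + t) ⁻¹) (⁻¹-involutive (s - t)) ⟨
  (s - t) ⁻¹ ⁻¹ * (s + t) ⁻¹      ≡⟨ ℚ.*-comm ((s - t) ⁻¹ ⁻¹) ((s + t) ⁻¹) ⟩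
  (s + t) ⁻¹ * (s - t) ⁻¹ ⁻¹      ≡⟨ ⁻¹-distrib-* (s + t) ((s - t) ⁻¹) ⟨
  ((s + t) * (s - t) ⁻¹) ⁻¹       ∎
  where open ≡-Reasoning

-p≡-1*p : ∀ p → - p ≡ - 1ℚ * p
-p≡-1*p p = trans (cong -_ (sym (ℚ.*-identityˡ p))) (ℚ.neg-distribˡ-* 1ℚ p)

ω-neg : ∀ s t → ω (- s) (- t) ≡ ω s t
ω-neg s t = trans (cong₂ ω (-p≡-1*p s) (-p≡-1*p t)) (ω-scale { - 1ℚ} s t λ ())

ω-negˡ : ∀ s t → ω (- s) t ≡ (ω s t) ⁻¹
ω-negˡ s t = begin
  ω (- s) t            ≡⟨ cong (ω (- s)) (solve 1 (λ t → :- (:- t) := t) refl t) ⟨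
  ω (- s) (- (- t))    ≡⟨ ω-neg s (- t) ⟩
  ω s (- t)            ≡⟨ ω-negʳ s t ⟩
  (ω s t) ⁻¹           ∎
  where open ≡-Reasoning

ω≢0 : ∀ {s t} → s + t ≢ 0ℚ → s ≢ t → ω s t ≢ 0ℚ
ω≢0 s+t≢0 s≢t = p*q≢0 s+t≢0 (p≢0⇒p⁻¹≢0 (p-q≢0 s≢t))

ℚ-semiring : Semiring _ _
ℚ-semiring = CommutativeRing.semiring ℚ.+-*-commutativeRing

open import Algebra.Properties.Semiring.Sum ℚ-semiring
  using (sum; sum-cong-≗; ∑-distrib-+; *-distribˡ-sum; *-distribʳ-sum)
open MonoidSum ℚ.+-0-monoid using (sum-++)
open MonoidSum ℚ.*-1-monoid using () renaming
  (sum to ∏; sumExcept to ∏-except; sum-cong-≗ to ∏-cong; sum-replicate-zero to ∏-replicate-1;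
   sumExcept-↑ˡ to ∏-except-↑ˡ; sumExcept-cong-≗ to ∏-except-cong; sumExcept-↑ʳ to ∏-except-↑ʳ)

∏≢0 : ∀ {n} {f : Vector ℚ n} → (∀ i → f i ≢ 0ℚ) → ∏ f ≢ 0ℚ
∏≢0 {zero}  f≢0 = 1≢0
∏≢0 {suc n} f≢0 = p*q≢0 (f≢0 zero) (∏≢0 (f≢0 ∘ suc))

∏-⁻¹ : ∀ {n} (f : Vector ℚ n) → (∏ f) ⁻¹ ≡ ∏ (λ i → (f i) ⁻¹)
∏-⁻¹ {zero}  f = 1⁻¹≡1
∏-⁻¹ {suc n} f = trans (⁻¹-distrib-* (f zero) (∏ (f ∘ suc))) (cong ((f zero) ⁻¹ *_) (∏-⁻¹ (f ∘ suc)))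

open import Algebra.Properties.Semiring.Exp ℚ-semiring using (_^_; ^-homo-*)

^≢0 : ∀ {a} n → a ≢ 0ℚ → a ^ n ≢ 0ℚ
^≢0 zero    a≢0 = 1≢0
^≢0 (suc n) a≢0 = p*q≢0 a≢0 (^≢0 n a≢0)

infixr 8 _^ℤ_
_^ℤ_ : ℚ → ℤ → ℚ
a ^ℤ ℤ.+ n   = a ^ n
a ^ℤ -[1+ n ] = (a ^ suc n) ⁻¹

^ℤ≢0 : ∀ {a} h → a ≢ 0ℚ → a ^ℤ h ≢ 0ℚ
^ℤ≢0 (ℤ.+ n)      a≢0 = ^≢0 n a≢0
^ℤ≢0 -[1+ n ]   a≢0 = p≢0⇒p⁻¹≢0 (^≢0 (suc n) a≢0)

^ℤ-⊖ : ∀ {a} → a ≢ 0ℚ → ∀ m n → a ^ℤ (m ⊖ n) ≡ a ^ m * (a ^ n) ⁻¹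
^ℤ-⊖ {a} a≢0 m zero rewrite ℤ.⊖-≥ {m} {0} ℕ.z≤n = begin
  a ^ m              ≡⟨ ℚ.*-identityʳ (a ^ m) ⟨
  a ^ m * 1ℚ         ≡⟨ cong (a ^ m *_) 1⁻¹≡1 ⟨
  a ^ m * 1ℚ ⁻¹      ∎
  where open ≡-Reasoning
^ℤ-⊖ {a} a≢0 zero (suc n) rewrite ℤ.⊖-≤ {0} {suc n} ℕ.z≤n = sym (ℚ.*-identityˡ _)
^ℤ-⊖ {a} a≢0 (suc m) (suc n) rewrite ℤ.[1+m]⊖[1+n]≡m⊖n m n | ^ℤ-⊖ a≢0 m n = begin
  a ^ m * (a ^ n) ⁻¹                       ≡⟨ ℚ.*-identityˡ _ ⟨
  1ℚ * (a ^ m * (a ^ n) ⁻¹)                ≡⟨ cong (_* (a ^ m * (a ^ n) ⁻¹)) (⁻¹-inverseʳ a≢0) ⟨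
  (a * a ⁻¹) * (a ^ m * (a ^ n) ⁻¹)        ≡⟨ solve 4 (λ a i x y → (a :* i) :* (x :* y) := a :* x :* (i :* y)) refl a (a ⁻¹) (a ^ m) ((a ^ n) ⁻¹) ⟩
  a * a ^ m * (a ⁻¹ * (a ^ n) ⁻¹)          ≡⟨ cong (a * a ^ m *_) (⁻¹-distrib-* a (a ^ n)) ⟨
  a ^ suc m * (a ^ suc n) ⁻¹               ∎
  where open ≡-Reasoning

^ℤ-homo-+ : ∀ {a} → a ≢ 0ℚ → ∀ i j → a ^ℤ (i ℤ.+ j) ≡ a ^ℤ i * a ^ℤ j
^ℤ-homo-+ {a} a≢0 (ℤ.+ m)      (ℤ.+ n)      = ^-homo-* a m n
^ℤ-homo-+ {a} a≢0 (ℤ.+ m)      -[1+ n ]   = ^ℤ-⊖ a≢0 m (suc n)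
^ℤ-homo-+ {a} a≢0 -[1+ m ]   (ℤ.+ n)      = trans (^ℤ-⊖ a≢0 n (suc m)) (ℚ.*-comm (a ^ n) _)
^ℤ-homo-+ {a} a≢0 -[1+ m ]   -[1+ n ]   = begin
  (a ^ suc (suc (m ℕ.+ n))) ⁻¹            ≡⟨ cong (λ k → (a ^ suc k) ⁻¹) (ℕ.+-suc m n) ⟨
  (a ^ (suc m ℕ.+ suc n)) ⁻¹              ≡⟨ cong _⁻¹ (^-homo-* a (suc m) (suc n)) ⟩
  (a ^ suc m * a ^ suc n) ⁻¹              ≡⟨ ⁻¹-distrib-* (a ^ suc m) (a ^ suc n) ⟩
  (a ^ suc m) ⁻¹ * (a ^ suc n) ⁻¹         ∎
  where open ≡-Reasoning

^ℤ-neg : ∀ a i → a ^ℤ (ℤ.- i) ≡ (a ^ℤ i) ⁻¹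
^ℤ-neg a (ℤ.+ zero)   = sym 1⁻¹≡1
^ℤ-neg a (ℤ.+ suc n)  = refl
^ℤ-neg a -[1+ n ]   = sym (⁻¹-involutive _)

^-pos : ∀ {a} n → 0ℚ < a → 0ℚ < a ^ n
^-pos zero    0<a = ℚ.positive⁻¹ 1ℚ
^-pos (suc n) 0<a = pos*pos⇒pos 0<a (^-pos n 0<a)

^ℤ-pos : ∀ {a} h → 0ℚ < a → 0ℚ < a ^ℤ h
^ℤ-pos (ℤ.+ n)    0<a = ^-pos n 0<a
^ℤ-pos -[1+ n ]   0<a = pos⇒⁻¹-pos (^-pos (suc n) 0<a)

1<^suc : ∀ {a} n → 1ℚ < a → 1ℚ < a ^ suc n
1<^suc {a} zero    1<a = subst (1ℚ <_) (sym (ℚ.*-identityʳ a)) 1<a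
1<^suc {a} (suc n) 1<a = ℚ.<-trans (1<^suc zero 1<a)
  (ℚ.*-monoʳ-<-pos a {{ℚ.positive (1<a⇒0<a 1<a)}} (1<^suc n 1<a))

^ℤ≡1⇒≡0 : ∀ {a} h → 1ℚ < a → a ^ℤ h ≡ 1ℚ → h ≡ ℤ.0ℤ
^ℤ≡1⇒≡0     (ℤ.+ zero)  1<a _    = refl
^ℤ≡1⇒≡0     (ℤ.+ suc n) 1<a a^h≡1 = ⊥-elim (ℚ.<⇒≢ (1<^suc n 1<a) (sym a^h≡1))
^ℤ≡1⇒≡0 {a} -[1+ n ]    1<a a^h≡1 = ⊥-elim (ℚ.<⇒≢ (1<^suc n 1<a) (sym (begin
  a ^ suc n               ≡⟨ ⁻¹-involutive (a ^ suc n) ⟨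
  (a ^ suc n) ⁻¹ ⁻¹       ≡⟨ cong _⁻¹ a^h≡1 ⟩
  1ℚ ⁻¹                   ≡⟨ 1⁻¹≡1 ⟩
  1ℚ                      ∎)))
  where open ≡-Reasoning

^ℤ-injective : ∀ {a} → 1ℚ < a → Injective _≡_ _≡_ (a ^ℤ_)
^ℤ-injective {a} 1<a {i} {j} a^i≡a^j = ℤ.i-j≡0⇒i≡j i j (^ℤ≡1⇒≡0 (i ℤ.- j) 1<a (begin
  a ^ℤ (i ℤ.- j)              ≡⟨ ^ℤ-homo-+ a≢0 i (ℤ.- j) ⟩
  a ^ℤ i * a ^ℤ (ℤ.- j)       ≡⟨ cong₂ _*_ a^i≡a^j (^ℤ-neg a j) ⟩
  a ^ℤ j * (a ^ℤ j) ⁻¹        ≡⟨ ⁻¹-inverseʳ (^ℤ≢0 j a≢0) ⟩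
  1ℚ                          ∎))
  where
  open ≡-Reasoning
  a≢0 = 1<a⇒a≢0 1<a

eval : ℚ → Poly → ℚ
eval t []      = 0ℚ
eval t (c ∷ p) = c + t * eval t p

eval-+ₚ : ∀ t p r → eval t (p +ₚ r) ≡ eval t p + eval t r
eval-+ₚ t []      r       = sym (ℚ.+-identityˡ (eval t r))
eval-+ₚ t (c ∷ p) []      = sym (ℚ.+-identityʳ (eval t (c ∷ p)))
eval-+ₚ t (c ∷ p) (d ∷ r) rewrite eval-+ₚ t p r =
  solve 5 (λ c d t x y → (c :+ d) :+ t :* (x :+ y) := (c :+ t :* x) :+ (d :+ t :* y)) refl c d t (eval t p) (eval t r)

eval-scale : ∀ t c p → eval t (map (c *_) p) ≡ c * eval t p
eval-scale t c []      = sym (ℚ.*-zeroʳ c)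
eval-scale t c (d ∷ p) rewrite eval-scale t c p =
  solve 4 (λ c d t x → c :* d :+ t :* (c :* x) := c :* (d :+ t :* x)) refl c d t (eval t p)

eval-*ₚ : ∀ t p r → eval t (p *ₚ r) ≡ eval t p * eval t r
eval-*ₚ t []      r = sym (ℚ.*-zeroˡ (eval t r))
eval-*ₚ t (c ∷ p) r rewrite eval-+ₚ t (map (c *_) r) (0ℚ ∷ (p *ₚ r)) | eval-scale t c r | eval-*ₚ t p r =
  solve 4 (λ c t x y → c :* y :+ (con 0ℚ :+ t :* (x :* y)) := (c :+ t :* x) :* y) refl c t (eval t p) (eval t r)

eval--ₚ : ∀ t p → eval t (-ₚ p) ≡ - eval t p
eval--ₚ t []      = refl
eval--ₚ t (c ∷ p) rewrite eval--ₚ t p =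
  solve 3 (λ c t x → (:- c) :+ t :* (:- x) := :- (c :+ t :* x)) refl c t (eval t p)

isZeroₚ⇒eval≡0 : ∀ t p → isZeroₚ p ≡ true → eval t p ≡ 0ℚ
isZeroₚ⇒eval≡0 t []      _ = refl
isZeroₚ⇒eval≡0 t (c ∷ p) e with c ℚ.≟ 0ℚ
... | yes refl rewrite isZeroₚ⇒eval≡0 t p e = cong (0ℚ +_) (ℚ.*-zeroʳ t)

coeff-+ₚ : ∀ p r n → coeff (p +ₚ r) n ≡ coeff p n + coeff r n
coeff-+ₚ []      r       n       = sym (ℚ.+-identityˡ _)
coeff-+ₚ (c ∷ p) []      n       = sym (ℚ.+-identityʳ _)
coeff-+ₚ (c ∷ p) (d ∷ r) zero    = refl
coeff-+ₚ (c ∷ p) (d ∷ r) (suc n) = coeff-+ₚ p r n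

coeff--ₚ : ∀ p n → coeff (-ₚ p) n ≡ - coeff p n
coeff--ₚ []      n       = refl
coeff--ₚ (c ∷ p) zero    = refl
coeff--ₚ (c ∷ p) (suc n) = coeff--ₚ p n

divLinear : ℚ → Poly → Poly
divLinear a []          = []
divLinear a (c ∷ [])    = []
divLinear a (c ∷ d ∷ p) = eval a (d ∷ p) ∷ divLinear a (d ∷ p)

length-divLinear : ∀ a p → length (divLinear a p) ≡ ℕ.pred (length p)
length-divLinear a []          = refl
length-divLinear a (c ∷ [])    = refl
length-divLinear a (c ∷ d ∷ p) = cong suc (length-divLinear a (d ∷ p))

eval-divLinear : ∀ t a p → eval t p ≡ eval a p + (t - a) * eval t (divLinear a p)
eval-divLinear t a []          = solve 2 (λ t a → con 0ℚ := con 0ℚ :+ (t :- a) :* con 0ℚ) refl t a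
eval-divLinear t a (c ∷ [])    = solve 3 (λ c t a → c :+ t :* con 0ℚ := (c :+ a :* con 0ℚ) :+ (t :- a) :* con 0ℚ) refl c t a
eval-divLinear t a (c ∷ d ∷ p) rewrite eval-divLinear t a (d ∷ p) =
  solve 5 (λ c t a e q → c :+ t :* (e :+ (t :- a) :* q) := (c :+ a :* e) :+ (t :- a) :* (e :+ t :* q))
    refl c t a (eval a (d ∷ p)) (eval t (divLinear a (d ∷ p)))

root∧divLinear≈ₚ[]⇒≈ₚ[] : ∀ a p → eval a p ≡ 0ℚ → divLinear a p ≈ₚ [] → p ≈ₚ []
root∧divLinear≈ₚ[]⇒≈ₚ[] a []          _    _   n       = refl
root∧divLinear≈ₚ[]⇒≈ₚ[] a (c ∷ [])    p[a]≡0 _ zero    = trans (solve 2 (λ c a → c := c :+ a :* con 0ℚ) refl c a) p[a]≡0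
root∧divLinear≈ₚ[]⇒≈ₚ[] a (c ∷ [])    _    _   (suc n) = refl
root∧divLinear≈ₚ[]⇒≈ₚ[] a (c ∷ d ∷ p) p[a]≡0 q≈0 zero =
  trans (solve 2 (λ c a → c := c :+ a :* con 0ℚ) refl c a) (trans (cong (λ e → c + a * e) (sym (q≈0 zero))) p[a]≡0)
root∧divLinear≈ₚ[]⇒≈ₚ[] a (c ∷ d ∷ p) _    q≈0 (suc n) = root∧divLinear≈ₚ[]⇒≈ₚ[] a (d ∷ p) (q≈0 zero) (q≈0 ∘ suc) n

eval-divLinear-root : ∀ {a} t p → eval a p ≡ 0ℚ → eval t p ≡ (t - a) * eval t (divLinear a p)
eval-divLinear-root {a} t p p[a]≡0 = trans (eval-divLinear t a p)
  (trans (cong (_+ (t - a) * eval t (divLinear a p)) p[a]≡0) (ℚ.+-identityˡ _))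

vanishing⇒≈ₚ[] : (s : ℕ → ℚ) → Injective _≡_ _≡_ s → ∀ p → (∀ j → eval (s j) p ≡ 0ℚ) → p ≈ₚ []
vanishing⇒≈ₚ[] s s-inj p = go (length p) s s-inj p ℕ.≤-refl
  where
  go : ∀ n (s : ℕ → ℚ) → Injective _≡_ _≡_ s → ∀ p → length p ℕ.≤ n → (∀ j → eval (s j) p ≡ 0ℚ) → p ≈ₚ []
  go zero    s _     []      _     _      _ = refl
  go (suc n) s s-inj p       |p|≤n p[s]≡0   =
    root∧divLinear≈ₚ[]⇒≈ₚ[] (s 0) p (p[s]≡0 0) (go n (s ∘ suc) (ℕ.suc-injective ∘ s-inj) q |q|≤n q[s∘suc]≡0)
    where
    q = divLinear (s 0) p
    |q|≤n : length q ℕ.≤ n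
    |q|≤n = subst (ℕ._≤ n) (sym (length-divLinear (s 0) p)) (ℕ.pred-mono-≤ |p|≤n)
    q[s∘suc]≡0 : ∀ j → eval (s (suc j)) q ≡ 0ℚ
    q[s∘suc]≡0 j = [ ⊥-elim ∘ p-q≢0 (ℕ.1+n≢0 ∘ s-inj) , id ]′
      (p*q≡0⇒p≡0∨q≡0 (s (suc j) - s 0) (trans (sym (eval-divLinear-root (s (suc j)) p (p[s]≡0 0))) (p[s]≡0 (suc j))))

≈ₚ-from-eval : (s : ℕ → ℚ) → Injective _≡_ _≡_ s → ∀ p r → (∀ j → eval (s j) p ≡ eval (s j) r) → p ≈ₚ r
≈ₚ-from-eval s s-inj p r p[s]≡r[s] n = begin
  coeff p n                              ≡⟨ solve 2 (λ x y → x := (x :+ :- y) :+ y) refl (coeff p n) (coeff r n) ⟩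
  (coeff p n + - coeff r n) + coeff r n  ≡⟨ cong (_+ coeff r n) (trans (coeff-+ₚ p (-ₚ r) n) (cong (coeff p n +_) (coeff--ₚ r n))) ⟨
  coeff (p +ₚ -ₚ r) n + coeff r n        ≡⟨ cong (_+ coeff r n) (vanishing⇒≈ₚ[] s s-inj (p +ₚ -ₚ r) p-r[s]≡0 n) ⟩
  0ℚ + coeff r n                         ≡⟨ ℚ.+-identityˡ _ ⟩
  coeff r n                              ∎
  where
  open ≡-Reasoning
  p-r[s]≡0 : ∀ j → eval (s j) (p +ₚ -ₚ r) ≡ 0ℚ
  p-r[s]≡0 j rewrite eval-+ₚ (s j) p (-ₚ r) | eval--ₚ (s j) r | p[s]≡r[s] j = ℚ.+-inverseʳ (eval (s j) r)

record HasValue (a : ℚ) (f : Frac) (v : ℚ) : Set where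
  constructor hasValue
  field
    den≢0 : eval a (den f) ≢ 0ℚ
    num≡  : eval a (num f) ≡ v * eval a (den f)

module _ {a : ℚ} where

  private
    eval-den-*ₚ≢0 : ∀ {f g u v} → HasValue a f u → HasValue a g v → eval a (den f *ₚ den g) ≢ 0ℚ
    eval-den-*ₚ≢0 {f} {g} (hasValue f≢0 _) (hasValue g≢0 _) e = p*q≢0 f≢0 g≢0 (trans (sym (eval-*ₚ a (den f) (den g))) e)

  HasValue-+F : ∀ {f g u v} → HasValue a f u → HasValue a g v → HasValue a (f +F g) (u + v)
  HasValue-+F {f} {g} {u} {v} f↦u@(hasValue _ f≡) g↦v@(hasValue _ g≡) = hasValue (eval-den-*ₚ≢0 f↦u g↦v) (begin
      eval a (num f *ₚ den g +ₚ num g *ₚ den f)          ≡⟨ eval-+ₚ a (num f *ₚ den g) (num g *ₚ den f) ⟩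
      eval a (num f *ₚ den g) + eval a (num g *ₚ den f)  ≡⟨ cong₂ _+_ (eval-*ₚ a (num f) (den g)) (eval-*ₚ a (num g) (den f)) ⟩
      F * G′ + G * F′                                    ≡⟨ cong₂ (λ x y → x * G′ + y * F′) f≡ g≡ ⟩
      u * F′ * G′ + v * G′ * F′                          ≡⟨ solve 4 (λ u v x y → u :* x :* y :+ v :* y :* x := (u :+ v) :* (x :* y)) refl u v F′ G′ ⟩
      (u + v) * (F′ * G′)                                ≡⟨ cong ((u + v) *_) (eval-*ₚ a (den f) (den g)) ⟨
      (u + v) * eval a (den f *ₚ den g)                  ∎)
    where
    open ≡-Reasoning
    F = eval a (num f); G = eval a (num g); F′ = eval a (den f); G′ = eval a (den g)

  HasValue-*F : ∀ {f g u v} → HasValue a f u → HasValue a g v → HasValue a (f *F g) (u * v)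
  HasValue-*F {f} {g} {u} {v} f↦u@(hasValue _ f≡) g↦v@(hasValue _ g≡) = hasValue (eval-den-*ₚ≢0 f↦u g↦v) (begin
      eval a (num f *ₚ num g)                ≡⟨ eval-*ₚ a (num f) (num g) ⟩
      eval a (num f) * eval a (num g)        ≡⟨ cong₂ _*_ f≡ g≡ ⟩
      u * F′ * (v * G′)                      ≡⟨ solve 4 (λ u v x y → u :* x :* (v :* y) := (u :* v) :* (x :* y)) refl u v F′ G′ ⟩
      (u * v) * (F′ * G′)                    ≡⟨ cong ((u * v) *_) (eval-*ₚ a (den f) (den g)) ⟨
      (u * v) * eval a (den f *ₚ den g)      ∎)
    where
    open ≡-Reasoning
    F′ = eval a (den f); G′ = eval a (den g)

  HasValue--F : ∀ {f v} → HasValue a f v → HasValue a (-F f) (- v)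
  HasValue--F {f} {v} (hasValue f≢0 f≡) = hasValue f≢0 (begin
    eval a (-ₚ num f)       ≡⟨ eval--ₚ a (num f) ⟩
    - eval a (num f)        ≡⟨ cong -_ f≡ ⟩
    - (v * eval a (den f))  ≡⟨ ℚ.neg-distribˡ-* v (eval a (den f)) ⟩
    - v * eval a (den f)    ∎)
    where open ≡-Reasoning

  HasValue-invF : ∀ {f v} → HasValue a f v → v ≢ 0ℚ → HasValue a (invF f) (v ⁻¹)
  HasValue-invF {f} {v} (hasValue f≢0 f≡) v≢0 with isZeroₚ (num f) in f≡0
  ... | true  = ⊥-elim (p*q≢0 v≢0 f≢0 (trans (sym f≡) (isZeroₚ⇒eval≡0 a (num f) f≡0)))
  ... | false = hasValue (λ e → p*q≢0 v≢0 f≢0 (trans (sym f≡) e)) (begin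
    eval a (den f)                    ≡⟨ ℚ.*-identityˡ _ ⟨
    1ℚ * eval a (den f)               ≡⟨ cong (_* eval a (den f)) (trans (ℚ.*-comm (v ⁻¹) v) (⁻¹-inverseʳ v≢0)) ⟨
    (v ⁻¹ * v) * eval a (den f)       ≡⟨ ℚ.*-assoc (v ⁻¹) v _ ⟩
    v ⁻¹ * (v * eval a (den f))       ≡⟨ cong (v ⁻¹ *_) f≡ ⟨
    v ⁻¹ * eval a (num f)             ∎)
    where open ≡-Reasoning

  private
    eval-one : eval a (1ℚ ∷ []) ≡ 1ℚ
    eval-one = cong (1ℚ +_) (ℚ.*-zeroʳ a)

  HasValue-1F : HasValue a 1F 1ℚ
  HasValue-1F = hasValue (λ e → 1≢0 (trans (sym eval-one) e)) (sym (ℚ.*-identityˡ _))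

  HasValue-0F : HasValue a 0F 0ℚ
  HasValue-0F = hasValue (λ e → 1≢0 (trans (sym eval-one) e)) (sym (ℚ.*-zeroˡ (eval a (1ℚ ∷ []))))

  HasValue-qF : HasValue a qF a
  HasValue-qF = hasValue (λ e → 1≢0 (trans (sym eval-one) e)) (ℚ.+-identityˡ (a * eval a (1ℚ ∷ [])))

  HasValue-powℕ : ∀ n → HasValue a (powℕ qF n) (a ^ n)
  HasValue-powℕ zero    = HasValue-1F
  HasValue-powℕ (suc n) = HasValue-*F HasValue-qF (HasValue-powℕ n)

  HasValue-powℤ : a ≢ 0ℚ → ∀ h → HasValue a (powℤ qF h) (a ^ℤ h)
  HasValue-powℤ a≢0 (ℤ.+ n)  = HasValue-powℕ n
  HasValue-powℤ a≢0 -[1+ n ] = HasValue-invF (HasValue-powℕ (suc n)) (^≢0 (suc n) a≢0)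

  HasValue-w : 1ℚ < a → ∀ {h} → h ≢ ℤ.0ℤ → HasValue a (w h) (ω 1ℚ (a ^ℤ h))
  HasValue-w 1<a {h} h≢0 = HasValue-*F (HasValue-+F HasValue-1F a^h)
    (HasValue-invF (HasValue-+F HasValue-1F (HasValue--F a^h)) (p-q≢0 (h≢0 ∘ ^ℤ≡1⇒≡0 h 1<a ∘ sym)))
    where a^h = HasValue-powℤ (1<a⇒a≢0 1<a) h

  HasValue-w-sub : 1ℚ < a → ∀ {h₁ h₂} → h₁ ≢ h₂ → HasValue a (w (h₁ ℤ.- h₂)) (ω (a ^ℤ h₂) (a ^ℤ h₁))
  HasValue-w-sub 1<a {h₁} {h₂} h₁≢h₂ = subst (HasValue a (w (h₁ ℤ.- h₂))) (begin
    ω 1ℚ (a ^ℤ (h₁ ℤ.- h₂))                          ≡⟨ ω-scale 1ℚ _ (^ℤ≢0 h₂ a≢0) ⟨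
    ω (a ^ℤ h₂ * 1ℚ) (a ^ℤ h₂ * a ^ℤ (h₁ ℤ.- h₂))      ≡⟨ cong₂ ω (ℚ.*-identityʳ (a ^ℤ h₂)) (sym (^ℤ-homo-+ a≢0 h₂ (h₁ ℤ.- h₂))) ⟩
    ω (a ^ℤ h₂) (a ^ℤ (h₂ ℤ.+ (h₁ ℤ.- h₂)))           ≡⟨ cong (ω (a ^ℤ h₂) ∘ (a ^ℤ_)) (trans (sym (ℤ.+-assoc h₂ h₁ (ℤ.- h₂))) (xyx⁻¹≈y h₂ h₁)) ⟩
    ω (a ^ℤ h₂) (a ^ℤ h₁)                             ∎)
    (HasValue-w 1<a (h₁≢h₂ ∘ ℤ.i-j≡0⇒i≡j h₁ h₂))
    where
    open ≡-Reasoning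
    a≢0 = 1<a⇒a≢0 1<a

  HasValue-sumF : ∀ {n} {f : Vector Frac n} {v : Vector ℚ n} → (∀ i → HasValue a (f i) (v i)) → HasValue a (sumF f) (sum v)
  HasValue-sumF {zero}  f↦v = HasValue-0F
  HasValue-sumF {suc n} f↦v = HasValue-+F (f↦v zero) (HasValue-sumF (f↦v ∘ suc))

  HasValue-prodF : ∀ {n} {f : Vector Frac n} {v : Vector ℚ n} → (∀ i → HasValue a (f i) (v i)) → HasValue a (prodF f) (∏ v)
  HasValue-prodF {zero}  f↦v = HasValue-1F
  HasValue-prodF {suc n} f↦v = HasValue-*F (f↦v zero) (HasValue-prodF (f↦v ∘ suc))

  HasValue-prodExcept : ∀ {n} k {f : Vector Frac n} {v : Vector ℚ n} → (∀ i → i ≢ k → HasValue a (f i) (v i)) →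
                        HasValue a (prodExcept k f) (∏-except k v)
  HasValue-prodExcept k {f} {v} f↦v = HasValue-prodF factor
    where
    factor : ∀ i → HasValue a (if does (i ≟ k) then 1F else f i) (if does (i ≟ k) then 1ℚ else v i)
    factor i with i ≟ k
    ... | yes _   = HasValue-1F
    ... | no  i≢k = f↦v i i≢k

≈F-from-values : (s : ℕ → ℚ) → Injective _≡_ _≡_ s → ∀ {f g} {v : ℕ → ℚ} →
                 (∀ j → HasValue (s j) f (v j)) → (∀ j → HasValue (s j) g (v j)) → f ≈F g
≈F-from-values s s-inj {f} {g} {v} f↦v g↦v = ≈ₚ-from-eval s s-inj (num f *ₚ den g) (num g *ₚ den f) λ j → begin
  eval (s j) (num f *ₚ den g)                   ≡⟨ eval-*ₚ (s j) (num f) (den g) ⟩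
  eval (s j) (num f) * eval (s j) (den g)       ≡⟨ cong (_* eval (s j) (den g)) (HasValue.num≡ (f↦v j)) ⟩
  v j * eval (s j) (den f) * eval (s j) (den g) ≡⟨ solve 3 (λ v F G → v :* F :* G := v :* G :* F) refl (v j) (eval (s j) (den f)) (eval (s j) (den g)) ⟩
  v j * eval (s j) (den g) * eval (s j) (den f) ≡⟨ cong (_* eval (s j) (den f)) (HasValue.num≡ (g↦v j)) ⟨
  eval (s j) (num g) * eval (s j) (den f)       ≡⟨ eval-*ₚ (s j) (num g) (den f) ⟨
  eval (s j) (num g *ₚ den f)                   ∎
  where open ≡-Reasoning

δ : ℚ → ℚ → ℚ
δ u t = (u + u) * (u - t) ⁻¹

ω≡-1+δ : ∀ {s t} → s ≢ t → ω s t ≡ - 1ℚ + δ s t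
ω≡-1+δ {s} {t} s≢t = begin
  (s + t) * p                       ≡⟨ solve 3 (λ s t p → (s :+ t) :* p := :- ((s :- t) :* p) :+ (s :+ s) :* p) refl s t p ⟩
  - ((s - t) * p) + (s + s) * p     ≡⟨ cong (λ x → - x + (s + s) * p) (⁻¹-inverseʳ (p-q≢0 s≢t)) ⟩
  - 1ℚ + (s + s) * p                ∎
  where
  open ≡-Reasoning
  p = (s - t) ⁻¹

ω/[u-t]-partialFractions : ∀ {s u t} → s ≢ t → u ≢ t → s ≢ u →
                           ω s t * (u - t) ⁻¹ ≡ (u - s) ⁻¹ * δ s t + ω s u * (u - t) ⁻¹
ω/[u-t]-partialFractions {s} {u} {t} s≢t u≢t s≢u = begin
  (s + t) * p * q                                                 ≡⟨ ℚ.*-identityʳ _ ⟨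
  (s + t) * p * q * 1ℚ                                            ≡⟨ cong ((s + t) * p * q *_) (⁻¹-inverseʳ (p-q≢0 (s≢u ∘ sym))) ⟨
  (s + t) * p * q * ((u - s) * r)                                 ≡⟨ solve 6 (λ s u t p q r →
                                                                       (s :+ t) :* p :* q :* ((u :- s) :* r)
                                                                    := r :* ((s :+ s) :* p) :* ((u :- t) :* q) :+ (s :+ u) :* (:- r) :* q :* ((s :- t) :* p))
                                                                     refl s u t p q r ⟩
  r * ((s + s) * p) * ((u - t) * q) + (s + u) * (- r) * q * ((s - t) * p)
                                                                  ≡⟨ cong₂ (λ x y → r * ((s + s) * p) * x + (s + u) * (- r) * q * y)
                                                                       (⁻¹-inverseʳ (p-q≢0 u≢t)) (⁻¹-inverseʳ (p-q≢0 s≢t)) ⟩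
  r * ((s + s) * p) * 1ℚ + (s + u) * (- r) * q * 1ℚ               ≡⟨ cong₂ _+_ (ℚ.*-identityʳ (r * δ s t)) (ℚ.*-identityʳ ((s + u) * (- r) * q)) ⟩
  r * δ s t + (s + u) * (- r) * q                                 ≡⟨ cong (λ x → r * δ s t + (s + u) * x * q) [s-u]⁻¹≡-r ⟨
  r * δ s t + (s + u) * (s - u) ⁻¹ * q                            ∎
  where
  open ≡-Reasoning
  p = (s - t) ⁻¹
  q = (u - t) ⁻¹
  r = (u - s) ⁻¹
  [s-u]⁻¹≡-r : (s - u) ⁻¹ ≡ - r
  [s-u]⁻¹≡-r = trans (cong _⁻¹ (solve 2 (λ s u → s :- u := :- (u :- s)) refl s u)) (neg-distrib-⁻¹ (u - s))

ω*δ-partialFractions : ∀ {s u t} → s ≢ t → u ≢ t → s ≢ u →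
                       ω s t * δ u t ≡ δ u s * δ s t + ω s u * δ u t
ω*δ-partialFractions {s} {u} {t} s≢t u≢t s≢u = begin
  ω s t * ((u + u) * (u - t) ⁻¹)                                 ≡⟨ solve 3 (λ x v q → x :* (v :* q) := v :* (x :* q)) refl (ω s t) (u + u) ((u - t) ⁻¹) ⟩
  (u + u) * (ω s t * (u - t) ⁻¹)                                 ≡⟨ cong ((u + u) *_) (ω/[u-t]-partialFractions s≢t u≢t s≢u) ⟩
  (u + u) * ((u - s) ⁻¹ * δ s t + ω s u * (u - t) ⁻¹)             ≡⟨ solve 5 (λ v r d x q → v :* (r :* d :+ x :* q) := v :* r :* d :+ x :* (v :* q))
                                                                      refl (u + u) ((u - s) ⁻¹) (δ s t) (ω s u) ((u - t) ⁻¹) ⟩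
  δ u s * δ s t + ω s u * δ u t                                  ∎
  where open ≡-Reasoning

coefficient : ∀ {n} → Vector ℚ n → Fin n → ℚ
coefficient z k = ∏-except k (λ r → ω (z r) (z k))

∏ω-partialFractions : ∀ {n} (z : Vector ℚ n) → Injective _≡_ _≡_ z → ∀ {t} → (∀ r → z r ≢ t) →
                      ∏ (λ r → ω (z r) t) ≡ (- 1ℚ) ^ n + sum (λ k → coefficient z k * δ (z k) t)
∏ω-partialFractions {zero}  z _     _   = sym (ℚ.+-identityʳ 1ℚ)
∏ω-partialFractions {suc n} z z-inj {t} z≢t = begin
  ω z₀ t * ∏ (λ r → ω (z′ r) t)
    ≡⟨ cong (ω z₀ t *_) (∏ω-partialFractions z′ z′-inj (z≢t ∘ suc)) ⟩
  ω z₀ t * (σ + sum T)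
    ≡⟨ ℚ.*-distribˡ-+ (ω z₀ t) σ (sum T) ⟩
  ω z₀ t * σ + ω z₀ t * sum T
    ≡⟨ cong₂ _+_ (cong (_* σ) (ω≡-1+δ (z≢t zero))) (*-distribˡ-sum (ω z₀ t) T) ⟩
  (- 1ℚ + δ z₀ t) * σ + sum (λ k → ω z₀ t * T k)
    ≡⟨ cong ((- 1ℚ + δ z₀ t) * σ +_) (trans (sum-cong-≗ expand) (∑-distrib-+ (λ k → A k * δ z₀ t) B)) ⟩
  (- 1ℚ + δ z₀ t) * σ + (sum (λ k → A k * δ z₀ t) + sum B)
    ≡⟨ cong (λ x → (- 1ℚ + δ z₀ t) * σ + (x + sum B)) (*-distribʳ-sum (δ z₀ t) A) ⟨
  (- 1ℚ + δ z₀ t) * σ + (sum A * δ z₀ t + sum B)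
    ≡⟨ solve 4 (λ d σ X S → (:- con 1ℚ :+ d) :* σ :+ (X :* d :+ S) := :- con 1ℚ :* σ :+ ((σ :+ X) :* d :+ S))
         refl (δ z₀ t) σ (sum A) (sum B) ⟩
  - 1ℚ * σ + ((σ + sum A) * δ z₀ t + sum B)
    ≡⟨ cong (λ x → - 1ℚ * σ + (x * δ z₀ t + sum B)) (∏ω-partialFractions z′ z′-inj z′≢z₀) ⟨
  - 1ℚ * σ + (∏ (λ r → ω (z′ r) z₀) * δ z₀ t + sum B)
    ≡⟨ cong (λ x → - 1ℚ * σ + (x * δ z₀ t + sum B)) (ℚ.*-identityˡ (∏ (λ r → ω (z′ r) z₀))) ⟨
  - 1ℚ * σ + (coefficient z zero * δ z₀ t + sum B)
    ∎
  where
  open ≡-Reasoning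
  z₀ = z zero
  z′ = z ∘ suc
  σ = (- 1ℚ) ^ n
  c′ = coefficient z′
  T A B : Vector ℚ n
  T k = c′ k * δ (z′ k) t
  A k = c′ k * δ (z′ k) z₀
  B k = coefficient z (suc k) * δ (z′ k) t
  z′-inj : Injective _≡_ _≡_ z′
  z′-inj = Fin.suc-injective ∘ z-inj
  z′≢z₀ : ∀ k → z′ k ≢ z₀
  z′≢z₀ k = Fin.0≢1+n ∘ sym ∘ z-inj
  expand : ∀ k → ω z₀ t * T k ≡ A k * δ z₀ t + B k
  expand k = begin
    ω z₀ t * (c′ k * δ (z′ k) t)                         ≡⟨ solve 3 (λ x c d → x :* (c :* d) := c :* (x :* d)) refl (ω z₀ t) (c′ k) (δ (z′ k) t) ⟩
    c′ k * (ω z₀ t * δ (z′ k) t)                         ≡⟨ cong (c′ k *_) (ω*δ-partialFractions (z≢t zero) (z≢t (suc k)) (z′≢z₀ k ∘ sym)) ⟩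
    c′ k * (δ (z′ k) z₀ * δ z₀ t + ω z₀ (z′ k) * δ (z′ k) t)
      ≡⟨ solve 5 (λ c a b x d → c :* (a :* b :+ x :* d) := c :* a :* b :+ x :* c :* d) refl (c′ k) (δ (z′ k) z₀) (δ z₀ t) (ω z₀ (z′ k)) (δ (z′ k) t) ⟩
    c′ k * δ (z′ k) z₀ * δ z₀ t + ω z₀ (z′ k) * c′ k * δ (z′ k) t  ∎

ω[s,0]≡1 : ∀ {s} → s ≢ 0ℚ → ω s 0ℚ ≡ 1ℚ
ω[s,0]≡1 {s} s≢0 = trans (cong₂ (λ x y → x * y ⁻¹) (ℚ.+-identityʳ s) (solve 1 (λ s → s :- con 0ℚ := s) refl s)) (⁻¹-inverseʳ s≢0)

δ[s,0]≡2 : ∀ {s} → s ≢ 0ℚ → δ s 0ℚ ≡ 1ℚ + 1ℚ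
δ[s,0]≡2 {s} s≢0 = begin
  (s + s) * (s - 0ℚ) ⁻¹          ≡⟨ cong (λ x → (s + s) * x ⁻¹) (solve 1 (λ s → s :- con 0ℚ := s) refl s) ⟩
  (s + s) * s ⁻¹                 ≡⟨ solve 2 (λ s i → (s :+ s) :* i := s :* i :+ s :* i) refl s (s ⁻¹) ⟩
  s * s ⁻¹ + s * s ⁻¹            ≡⟨ cong (λ x → x + x) (⁻¹-inverseʳ s≢0) ⟩
  1ℚ + 1ℚ                        ∎
  where open ≡-Reasoning

[-1]^[m+m]≡1 : ∀ m → (- 1ℚ) ^ (m ℕ.+ m) ≡ 1ℚ
[-1]^[m+m]≡1 zero    = refl
[-1]^[m+m]≡1 (suc m) rewrite ℕ.+-suc m m | [-1]^[m+m]≡1 m = refl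

p*2≡2⇒p≡1 : ∀ {p} → p * (1ℚ + 1ℚ) ≡ 1ℚ + 1ℚ → p ≡ 1ℚ
p*2≡2⇒p≡1 {p} p*2≡2 = begin
  p                                  ≡⟨ ℚ.*-identityʳ p ⟨
  p * 1ℚ                             ≡⟨ cong (p *_) (⁻¹-inverseʳ {1ℚ + 1ℚ} λ ()) ⟨
  p * ((1ℚ + 1ℚ) * (1ℚ + 1ℚ) ⁻¹)     ≡⟨ ℚ.*-assoc p _ _ ⟨
  p * (1ℚ + 1ℚ) * (1ℚ + 1ℚ) ⁻¹       ≡⟨ cong (_* (1ℚ + 1ℚ) ⁻¹) p*2≡2 ⟩
  (1ℚ + 1ℚ) * (1ℚ + 1ℚ) ⁻¹           ≡⟨ ⁻¹-inverseʳ {1ℚ + 1ℚ} (λ ()) ⟩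
  1ℚ                                 ∎
  where open ≡-Reasoning

∑coefficient≡1 : ∀ m (z : Vector ℚ (suc (m ℕ.+ m))) → Injective _≡_ _≡_ z → (∀ r → z r ≢ 0ℚ) →
                 sum (coefficient z) ≡ 1ℚ
∑coefficient≡1 m z z-inj z≢0 = p*2≡2⇒p≡1 (sym (begin
  1ℚ + 1ℚ                                                         ≡⟨ cong (_+ 1ℚ) ∏ω[z,0]≡1 ⟨
  ∏ (λ r → ω (z r) 0ℚ) + 1ℚ                                       ≡⟨ cong (_+ 1ℚ) (∏ω-partialFractions z z-inj z≢0) ⟩
  (- 1ℚ * (- 1ℚ) ^ (m ℕ.+ m) + sum (λ k → c k * δ (z k) 0ℚ)) + 1ℚ  ≡⟨ cong₂ (λ x y → (- 1ℚ * x + y) + 1ℚ) ([-1]^[m+m]≡1 m) ∑cδ≡S*2 ⟩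
  (- 1ℚ * 1ℚ + S * (1ℚ + 1ℚ)) + 1ℚ                                ≡⟨ solve 1 (λ S → (:- con 1ℚ :* con 1ℚ :+ S :* (con 1ℚ :+ con 1ℚ)) :+ con 1ℚ
                                                                                 := S :* (con 1ℚ :+ con 1ℚ)) refl S ⟩
  S * (1ℚ + 1ℚ)                                                   ∎))
  where
  open ≡-Reasoning
  c = coefficient z
  S = sum c
  ∏ω[z,0]≡1 : ∏ (λ r → ω (z r) 0ℚ) ≡ 1ℚ
  ∏ω[z,0]≡1 = trans (∏-cong (ω[s,0]≡1 ∘ z≢0)) (∏-replicate-1 (suc (m ℕ.+ m)))
  ∑cδ≡S*2 : sum (λ k → c k * δ (z k) 0ℚ) ≡ S * (1ℚ + 1ℚ)
  ∑cδ≡S*2 = trans (sum-cong-≗ (λ k → cong (c k *_) (δ[s,0]≡2 (z≢0 k)))) (sym (*-distribʳ-sum (1ℚ + 1ℚ) c))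

coefficient-++ˡ : ∀ {p q} (U : Vector ℚ p) (W : Vector ℚ q) k →
                  coefficient (U ++ W) (k ↑ˡ q) ≡ coefficient U k * ∏ (λ j → ω (W j) (U k))
coefficient-++ˡ {p} {q} U W k = begin
  ∏-except (k ↑ˡ q) (λ r → ω (z r) (z (k ↑ˡ q)))                    ≡⟨ cong (λ u → ∏-except (k ↑ˡ q) (λ r → ω (z r) u)) (lookup-++ˡ U W k) ⟩
  ∏-except (k ↑ˡ q) (λ r → ω (z r) (U k))                           ≡⟨ ∏-except-↑ˡ k (λ r → ω (z r) (U k)) ⟩
  ∏-except k (λ i → ω (z (i ↑ˡ q)) (U k)) * ∏ (λ j → ω (z (p ↑ʳ j)) (U k))
                                                                    ≡⟨ cong₂ _*_ (∏-except-cong k (λ i → cong (λ u → ω u (U k)) (lookup-++ˡ U W i)))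
                                                                                 (∏-cong (λ j → cong (λ u → ω u (U k)) (lookup-++ʳ U W j))) ⟩
  coefficient U k * ∏ (λ j → ω (W j) (U k))                         ∎
  where
  open ≡-Reasoning
  z = U ++ W

coefficient-++ʳ : ∀ {p q} (U : Vector ℚ p) (W : Vector ℚ q) k →
                  coefficient (U ++ W) (p ↑ʳ k) ≡ ∏ (λ i → ω (U i) (W k)) * coefficient W k
coefficient-++ʳ {p} {q} U W k = begin
  ∏-except (p ↑ʳ k) (λ r → ω (z r) (z (p ↑ʳ k)))                    ≡⟨ cong (λ u → ∏-except (p ↑ʳ k) (λ r → ω (z r) u)) (lookup-++ʳ U W k) ⟩
  ∏-except (p ↑ʳ k) (λ r → ω (z r) (W k))                           ≡⟨ ∏-except-↑ʳ p k (λ r → ω (z r) (W k)) ⟩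
  ∏ (λ i → ω (z (i ↑ˡ q)) (W k)) * ∏-except k (λ j → ω (z (p ↑ʳ j)) (W k))
                                                                    ≡⟨ cong₂ _*_ (∏-cong (λ i → cong (λ u → ω u (W k)) (lookup-++ˡ U W i)))
                                                                                 (∏-except-cong k (λ j → cong (λ u → ω u (W k)) (lookup-++ʳ U W j))) ⟩
  ∏ (λ i → ω (U i) (W k)) * coefficient W k                         ∎
  where
  open ≡-Reasoning
  z = U ++ W

coefficient-neg : ∀ {n} (V : Vector ℚ n) k → coefficient (-_ ∘ V) k ≡ coefficient V k
coefficient-neg V k = ∏-except-cong k (λ r → ω-neg (V r) (V k))

sample : ℕ → ℚ
sample zero    = 1ℚ + 1ℚ
sample (suc j) = sample j + 1ℚ

1<sample : ∀ j → 1ℚ < sample j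
1<sample zero    = p<p+1 1ℚ
1<sample (suc j) = ℚ.<-trans (1<sample j) (p<p+1 (sample j))

sample-mono : ∀ {j k} → j ℕ.< k → sample j < sample k
sample-mono {j} {suc k} (ℕ.s≤s j≤k) with ℕ.m≤n⇒m<n∨m≡n j≤k
... | inj₁ j<k  = ℚ.<-trans (sample-mono j<k) (p<p+1 (sample k))
... | inj₂ refl = p<p+1 (sample k)

sample-injective : Injective _≡_ _≡_ sample
sample-injective {j} {k} sj≡sk with ℕ.<-cmp j k
... | tri< j<k _ _ = ⊥-elim (ℚ.<⇒≢ (sample-mono j<k) sj≡sk)
... | tri≈ _ j≡k _ = j≡k
... | tri> _ _ k<j = ⊥-elim (ℚ.<⇒≢ (sample-mono k<j) (sym sj≡sk))

termValue : ∀ {p q} → ℚ → (Fin p → ℤ) → (Fin q → ℤ) → Fin p → ℚ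
termValue a u v k = coefficient ((a ^ℤ_) ∘ u) k * (∏ (λ j → ω (a ^ℤ v j) (a ^ℤ u k))) ⁻¹

HasValue-term : ∀ {a p q} {u : Fin p → ℤ} {v : Fin q → ℤ} → 1ℚ < a →
                Injective _≡_ _≡_ u → (∀ i j → u i ≢ v j) → ∀ k →
  HasValue a (prodExcept k (λ i → w (u k ℤ.- u i)) *F invF (prodF (λ i → w (u k ℤ.- v i)))) (termValue a u v k)
HasValue-term {a} {u = u} {v} 1<a u-inj u≢v k = HasValue-*F
  (HasValue-prodExcept k (λ i i≢k → HasValue-w-sub 1<a (i≢k ∘ sym ∘ u-inj)))
  (HasValue-invF (HasValue-prodF (λ j → HasValue-w-sub 1<a (u≢v k j)))
                 (∏≢0 (λ j → ω≢0 (pos+pos≢0 (^ℤ-pos (v j) 0<a) (^ℤ-pos (u k) 0<a)) (u≢v k j ∘ sym ∘ ^ℤ-injective 1<a))))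
  where 0<a = 1<a⇒0<a 1<a

∑termValue≡1 : ∀ {a m} {x : Fin (suc m) → ℤ} {y : Fin m → ℤ} → 1ℚ < a →
               Injective _≡_ _≡_ x → Injective _≡_ _≡_ y → (∀ i j → x i ≢ y j) →
               sum (termValue a x y) + sum (termValue a y x) ≡ 1ℚ
∑termValue≡1 {a} {m} {x} {y} 1<a x-inj y-inj x≢y = begin
  sum (termValue a x y) + sum (termValue a y x)                        ≡⟨ cong₂ _+_ (sum-cong-≗ left) (sum-cong-≗ right) ⟨
  sum (coefficient z ∘ (_↑ˡ m)) + sum (coefficient z ∘ (suc m ↑ʳ_))   ≡⟨ sum-++ (suc m) (coefficient z) ⟨
  sum (coefficient z)                                                  ≡⟨ ∑coefficient≡1 m z z-inj z≢0 ⟩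
  1ℚ                                                                   ∎
  where
  open ≡-Reasoning
  0<a = 1<a⇒0<a 1<a
  U = (a ^ℤ_) ∘ x
  V = (a ^ℤ_) ∘ y
  -- Negating the y-points turns the factors of each denominator into factors
  -- ω of a coefficient of z (ω-negˡ, ω-negʳ).
  z = U ++ (-_ ∘ V)
  left : ∀ k → coefficient z (k ↑ˡ m) ≡ termValue a x y k
  left k = trans (coefficient-++ˡ U (-_ ∘ V) k)
    (cong (coefficient U k *_) (trans (∏-cong (λ j → ω-negˡ (V j) (U k))) (sym (∏-⁻¹ (λ j → ω (V j) (U k))))))
  right : ∀ k → coefficient z (suc m ↑ʳ k) ≡ termValue a y x k
  right k = trans (coefficient-++ʳ U (-_ ∘ V) k) (trans
    (cong₂ _*_ (trans (∏-cong (λ i → ω-negʳ (U i) (V k))) (sym (∏-⁻¹ (λ i → ω (U i) (V k))))) (coefficient-neg V k))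
    (ℚ.*-comm (∏ (λ i → ω (U i) (V k)) ⁻¹) (coefficient V k)))
  z-inj : Injective _≡_ _≡_ z
  z-inj = ++-injective (x-inj ∘ ^ℤ-injective 1<a) (y-inj ∘ ^ℤ-injective 1<a ∘ ℚ.neg-injective)
    (λ i j Ui≡-Vj → pos+pos≢0 (^ℤ-pos (x i) 0<a) (^ℤ-pos (y j) 0<a) (trans (cong (_+ V j) Ui≡-Vj) (ℚ.+-inverseˡ (V j))))
  z≢0 : ∀ r → z r ≢ 0ℚ
  z≢0 = ++-all {P = _≢ 0ℚ} (λ i → ^ℤ≢0 (x i) (0<a⇒a≢0 0<a)) (λ j → ^ℤ≢0 (y j) (0<a⇒a≢0 0<a) ∘ ℚ.neg-injective)

proposition5p1 : (m : ℕ) (x : Fin (suc m) → ℤ) (y : Fin m → ℤ) →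
    Injective _≡_ _≡_ x → Injective _≡_ _≡_ y → (∀ i j → x i ≢ y j) →
    sumF (λ k → prodExcept k (λ i → w (x k ℤ.- x i)) *F invF (prodF (λ i → w (x k ℤ.- y i))))
      +F sumF (λ k → prodExcept k (λ i → w (y k ℤ.- y i)) *F invF (prodF (λ i → w (y k ℤ.- x i))))
      ≈F 1F
proposition5p1 m x y x-inj y-inj x≢y = ≈F-from-values sample sample-injective
  (λ j → subst (HasValue (sample j) _) (∑termValue≡1 (1<sample j) x-inj y-inj x≢y)
    (HasValue-+F (HasValue-sumF (HasValue-term (1<sample j) x-inj x≢y))
                 (HasValue-sumF (HasValue-term (1<sample j) y-inj (λ i j → x≢y j i ∘ sym)))))
  (λ _ → HasValue-1F)
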